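{- Let $\mathsf{K}$ be a non-trivial logical class of unital-meet-semilattice structures with $\mathsf{K} \subseteq \mathsf{uSL}_\infty$. Then either $\mathsf{uSL}_\omega \subseteq \mathsf{K}$, or $\mathsf{K} = \mathsf{uSL}_n$ for some integer $n \geq 1$.
   Context: A unital meet semilattice is an algebra $(S,\wedge,1)$ with $\wedge$ a meet-semilattice operation and $1$ the top element; homomorphisms preserve $\wedge$ and $1$. A structure is a pair $\langle\mathbf{A},F\rangle$ with $F \subseteq \mathbf{A}$; products are $\langle \prod_i \mathbf{A}_i, \prod_i F_i\rangle$; substructures are $\langle \mathbf{B}, F\cap B\rangle$ for subalgebras $\mathbf{B}$; a strict homomorphism $h\colon\langle \mathbf{A},F\rangle\to\langle\mathbf{B},G\rangle$ is a homomorphism with $F=h^{ -1}[G]$, and if surjective the domain structure is a strict homomorphic preimage and the codomain structure a strict homomorphic image. A logical class is a class of unital-meet-semilattice structures closed under isomorphic copies, substructures, products, strict homomorphic preimages and strict homomorphic images; it is trivial if every member $\langle\mathbf{A},F\rangle$ has $F=\mathbf{A}$. An $n$-filter of a meet semilattice $\mathbf{S}$ ($n\ge1$) is an upset $F$ such that for each non-empty finite $X\subseteq\mathbf{S}$, if $\bigwedge Y\in F$ for all $Y\subseteq X$ with $1\le|Y|\le n$ then $\bigwedge X\in F$. $\mathsf{uSL}_n$ ($n\ge 1$) is the class of $\langle\mathbf{S},F\rangle$ with $\mathbf{S}$ a unital meet semilattice and $F$ a non-empty $n$-filter; $\mathsf{uSL}_\infty$ the class with $F$ a non-empty upset; $\mathsf{uSL}_\omega$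 the class with $F$ a non-empty residually finite upset, i.e. an intersection of a family of sets $h^{ -1}[G]$ with $h\colon\mathbf{S}\to\mathbf{M}$ a homomorphism into a finite unital meet semilattice $\mathbf{M}$ and $G$ an upset of $\mathbf{M}$. -}

module Defs where

open import Level using (Level; _⊔_) renaming (suc to lsuc)
open import Algebra.Bundles using (IdempotentCommutativeMonoid)
open import Algebra.Structures using (IsIdempotentCommutativeMonoid)
open import Algebra.Morphism.Structures using (module MonoidMorphisms)
open import Data.Nat using (ℕ; suc; _≤_)
open import Data.Fin using (Fin)
open import Data.Product using (Σ; ∃; _×_; _,_; proj₁; proj₂)
open import Function.Bundles using (_⇔_)
open import Function.Definitions using (Injective)
open import Relation.Binary.Core using (Rel)
open import Relation.Unary using (Pred)
open import Relation.Nullary using (¬_)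

-- Unital meet semilattices (S, ∧, 1): idempotent commutative monoids,
-- the monoid unit being the top element 1.  Carrier and equality live
-- at a single level a (setoid-based, as usual in agda-stdlib).

USL : (a : Level) → Set (lsuc a)
USL a = IdempotentCommutativeMonoid a a

module _ {a : Level} where

  IsHom : (S T : USL a) → (IdempotentCommutativeMonoid.Carrier S →
                           IdempotentCommutativeMonoid.Carrier T) → Set a
  IsHom S T = MonoidMorphisms.IsMonoidHomomorphism
                (IdempotentCommutativeMonoid.rawMonoid S)
                (IdempotentCommutativeMonoid.rawMonoid T)

  module _ (S : USL a) where
    open IdempotentCommutativeMonoid S renaming (_∙_ to _∧_; ε to ⊤)

    _≤ₛ_ : Rel Carrier a
    x ≤ₛ y = (x ∧ y) ≈ x

    IsUpset : Pred Carrier a → Set a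
    IsUpset F = ∀ {x y} → x ≤ₛ y → F x → F y

    NonEmpty : Pred Carrier a → Set a
    NonEmpty F = ∃ λ x → F x

    ⋀ : ∀ {k} → (Fin (suc k) → Carrier) → Carrier
    ⋀ {ℕ.zero} X = X Fin.zero
    ⋀ {suc k} X = X Fin.zero ∧ ⋀ (λ i → X (Fin.suc i))

    -- X is given as an enumeration Fin (suc k) → S, a subset Y of size
    -- m+1 as an injective choice of positions Fin (suc m) → Fin (suc k).
    IsNFilter : ℕ → Pred Carrier a → Set a
    IsNFilter n F =
      IsUpset F ×
      (∀ k (X : Fin (suc k) → Carrier) →
        (∀ m (ι : Fin (suc m) → Fin (suc k)) →
            Injective _≡_ _≡_ ι → suc m ≤ n → F (⋀ (λ i → X (ι i)))) →
        F (⋀ X))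
      where open import Relation.Binary.PropositionalEquality using (_≡_)

  IsFinite : USL a → Set a
  IsFinite M = ∃ λ (n : ℕ) → Σ (Fin n → IdempotentCommutativeMonoid.Carrier M)
                 λ e → ∀ y → ∃ λ i → IdempotentCommutativeMonoid._≈_ M (e i) y

  IsResFinUpset : (S : USL a) → Pred (IdempotentCommutativeMonoid.Carrier S) a → Set (lsuc a)
  IsResFinUpset S F =
    Σ (Set a) λ J →
    Σ (J → USL a) λ M →
    Σ ((j : J) → IdempotentCommutativeMonoid.Carrier S → IdempotentCommutativeMonoid.Carrier (M j)) λ h →
    Σ ((j : J) → Pred (IdempotentCommutativeMonoid.Carrier (M j)) a) λ G →
      (∀ j → IsFinite (M j)) × (∀ j → IsHom S (M j) (h j)) × (∀ j → IsUpset (M j) (G j)) ×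
      (∀ x → F x ⇔ (∀ j → G j (h j x)))

record Str (a : Level) : Set (lsuc a) where
  field
    alg : USL a
  open IdempotentCommutativeMonoid alg public
  field
    F : Pred Carrier a
    F-resp : ∀ {x y} → x ≈ y → F x → F y

open Str

module _ {a : Level} where

  record StrictHom (A B : Str a) : Set a where
    field
      fun : Carrier A → Carrier B
      hom : IsHom (alg A) (alg B) fun
      strict : ∀ x → F A x ⇔ F B (fun x)

  Surj : ∀ {A B : Str a} → StrictHom A B → Set a
  Surj {A} {B} h = ∀ y → ∃ λ x → _≈_ B (StrictHom.fun h x) y

  Inj : ∀ {A B : Str a} → StrictHom A B → Set a
  Inj {A} {B} h = ∀ {x y} → _≈_ B (StrictHom.fun h x) (StrictHom.fun h y) → _≈_ A x y

  ∏ : (I : Set a) → (I → Str a) → Str a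
  ∏ I A = record
    { alg = record
      { Carrier = (i : I) → Carrier (A i)
      ; _≈_ = λ f g → ∀ i → _≈_ (A i) (f i) (g i)
      ; _∙_ = λ f g i → _∙_ (A i) (f i) (g i)
      ; ε = λ i → ε (A i)
      ; isIdempotentCommutativeMonoid = record
        { isCommutativeMonoid = record
          { isMonoid = record
            { isSemigroup = record
              { isMagma = record
                { isEquivalence = record
                  { refl = λ i → refl (A i)
                  ; sym = λ p i → sym (A i) (p i)
                  ; trans = λ p q i → trans (A i) (p i) (q i) }
                ; ∙-cong = λ p q i → ∙-cong (A i) (p i) (q i) }
              ; assoc = λ f g h i → assoc (A i) (f i) (g i) (h i) }
            ; identity = (λ f i → identityˡ (A i) (f i)) , (λ f i → identityʳ (A i) (f i)) }
          ; comm = λ f g i → comm (A i) (f i) (g i) }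
        ; idem = λ f i → idem (A i) (f i) } }
    ; F = λ f → ∀ i → F (A i) (f i)
    ; F-resp = λ p q i → F-resp (A i) (p i) (q i)
    }

  Class : (k : Level) → Set (lsuc a ⊔ lsuc k)
  Class k = Pred (Str a) k

  record IsLogicalClass {k : Level} (K : Class k) : Set (lsuc a ⊔ k) where
    field
      iso : ∀ {A B} (h : StrictHom A B) → Inj h → Surj h → K A → K B
      -- substructures: ⟨B', F ∩ B'⟩ for a subalgebra B' of A, given as an
      -- injective homomorphism e into A with F_B = e⁻¹[F_A]
      sub : ∀ {A B} (e : StrictHom B A) → Inj e → K A → K B
      prod : ∀ (I : Set a) (A : I → Str a) → (∀ i → K (A i)) → K (∏ I A)
      preimage : ∀ {A B} (h : StrictHom A B) → Surj h → K B → K A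
      image : ∀ {A B} (h : StrictHom A B) → Surj h → K A → K B

  Trivial : ∀ {k} → Class k → Set (lsuc a ⊔ k)
  Trivial K = ∀ A → K A → ∀ x → F A x

  uSL : ℕ → Class a
  uSL n A = NonEmpty (alg A) (F A) × IsNFilter (alg A) n (F A)

  uSL∞ : Class a
  uSL∞ A = NonEmpty (alg A) (F A) × IsUpset (alg A) (F A)

  uSLω : Class (lsuc a)
  uSLω A = NonEmpty (alg A) (F A) × IsUpset (alg A) (F A) × IsResFinUpset (alg A) (F A)

  _⊆ᶜ_ : ∀ {k l} → Class k → Class l → Set (lsuc a ⊔ k ⊔ l)
  K ⊆ᶜ L = ∀ A → K A → L A

  _≐ᶜ_ : ∀ {k l} → Class k → Class l → Set (lsuc a ⊔ k ⊔ l)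
  K ≐ᶜ L = ∀ A → K A ⇔ L A

-- Write 𝔹 n for the Boolean lattice 2ⁿ with the filter of its non-zero elements.
-- If an upset F of A containing 1 is not an n-filter, thinning out a failing family and then
-- merging elements yields n+1 elements whose meet lies outside F although the meet of any n of
-- them lies in F; sending a bit vector to the meet of the elements at its 0-positions is then a
-- strict homomorphism 𝔹 (n+1) → ⟨A,F⟩, so ⟨A,F⟩ ∈ K forces 𝔹 (n+1) ∈ K.
-- Conversely, if F is an intersection of unions of s filters, each with 𝔹 s ∈ K, the indicator
-- maps of the filters embed ⟨A,F⟩ strictly into a product of members of K. Residually finite
-- upsets have this form, since a finite upset is the union of the principal filters of its
-- elements; so does a non-empty n-filter once A is replaced by the free semilattice over it,
-- where a finite set X satisfies ⋀X ∈ F iff it misses a member of every family of at most n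
-- elements whose meet lies outside F.
-- Non-triviality of K gives 𝔹 1 ∈ K. Either every 𝔹 n lies in K, and then uSL_ω ⊆ K, or for the
-- largest n with 𝔹 n ∈ K one gets K = uSL_n.

module Submission where

open import Defs
open import Level using (Level; _⊔_; Lift; lift; lower) renaming (suc to lsuc)
open import Axiom.ExcludedMiddle using (ExcludedMiddle)
open import Axiom.DoubleNegationElimination using (DoubleNegationElimination; em⇒dne)
open import Algebra.Bundles using (IdempotentCommutativeMonoid; RawMonoid)
open import Algebra.Lattice.Bundles using (Semilattice)
import Algebra.Lattice.Properties.Semilattice as SemilatticeProperties
open import Algebra.Morphism.Structures using (module MonoidMorphisms)
open import Algebra.Properties.CommutativeSemigroup using (interchange)
import Algebra.Construct.Pointwise as Pointwise
open import Data.Bool as Bool using (Bool; true; false; T; if_then_else_)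
open import Data.Bool.Properties using (∧-isCommutativeMonoid; ∧-idem)
open import Data.Fin using (Fin; zero; suc; toℕ; fromℕ<; inject≤; punchIn; punchOut; _≟_)
open import Data.Fin.Properties
  using (suc-injective; toℕ-injective; toℕ-fromℕ<; toℕ-inject≤; toℕ<n; punchIn-punchOut; punchIn-injective)
  using (¬∀⟶∃¬)
open import Data.List using (List; []; _∷_; _++_; foldr; lookup; length)
open import Data.List.Properties using (++-assoc; ++-identityʳ)
open import Data.List.Relation.Unary.Any using (here; there)
import Data.List.Membership.Setoid as SetoidMembership
open import Data.List.Membership.Setoid.Properties using (∈-++⁺ˡ; ∈-++⁺ʳ; ∈-++⁻; ∈-++-comm; ∈-lookup)
import Data.List.Relation.Binary.Subset.Setoid as SetoidSubset
open import Data.List.Relation.Binary.Subset.Setoid.Properties using (⊆-preorder; ++⁺)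
open import Data.Nat as ℕ using (ℕ; zero; suc; _≥_; s≤s; z≤n)
import Data.Nat.Properties as ℕ
open import Data.Product using (Σ; ∃; _×_; _,_; proj₁; proj₂)
open import Data.Sum using (_⊎_; inj₁; inj₂; [_,_])
open import Function.Bundles using (_⇔_; mk⇔; Equivalence)
open import Function.Definitions using (Injective)
open import Relation.Binary.Bundles using (Setoid)
open import Relation.Binary.Lattice using (MeetSemilattice)
open import Relation.Binary.Properties.Preorder using (InducedEquivalence)
open import Relation.Binary.PropositionalEquality as ≡ using (_≡_; _≢_)
open import Relation.Nullary using (¬_; Dec; yes; no; does; contradiction)
open import Relation.Nullary.Decidable using (does-⇔; dec-true; _×-dec_; map′)
open import Relation.Unary using (Pred)

module Order {a : Level} (S : USL a) where
  open IdempotentCommutativeMonoid S renaming (_∙_ to _∧_; ε to ⊤)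

  private
    semilattice : Semilattice a a
    semilattice = record { isSemilattice = isCommutativeBand }

  open MeetSemilattice (SemilatticeProperties.∧-orderTheoreticMeetSemilattice semilattice) public
    using (_≤_ ; x∧y≤x; x∧y≤y; ∧-greatest; antisym)
    renaming (refl to ≤-refl; reflexive to ≤-reflexive; trans to ≤-trans)

  x≤⊤ : ∀ {x} → x ≤ ⊤
  x≤⊤ {x} = sym (identityʳ x)

  upward : ∀ {P : Pred Carrier a} → IsUpset S P → ∀ {x y} → x ≤ y → P x → P y
  upward isUpset x≤y = isUpset (sym x≤y)

  ⋀-lowerBound : ∀ {k} (X : Fin (suc k) → Carrier) i → ⋀ S X ≤ X i
  ⋀-lowerBound {zero} X zero = ≤-refl
  ⋀-lowerBound {suc k} X zero = x∧y≤x _ _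
  ⋀-lowerBound {suc k} X (suc i) = ≤-trans (x∧y≤y _ _) (⋀-lowerBound (λ j → X (suc j)) i)

  ⋀-greatest : ∀ {k} (X : Fin (suc k) → Carrier) {z} → (∀ i → z ≤ X i) → z ≤ ⋀ S X
  ⋀-greatest {zero} X z≤X = z≤X zero
  ⋀-greatest {suc k} X z≤X = ∧-greatest (z≤X zero) (⋀-greatest (λ j → X (suc j)) (λ i → z≤X (suc i)))

  ⋀-cong : ∀ {k} {X Y : Fin (suc k) → Carrier} → (∀ i → X i ≈ Y i) → ⋀ S X ≈ ⋀ S Y
  ⋀-cong {zero} X≈Y = X≈Y zero
  ⋀-cong {suc k} X≈Y = ∙-cong (X≈Y zero) (⋀-cong (λ i → X≈Y (suc i)))

  ⋀-∧ : ∀ {k} (X Y : Fin (suc k) → Carrier) → ⋀ S (λ i → X i ∧ Y i) ≈ (⋀ S X ∧ ⋀ S Y)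
  ⋀-∧ {zero} X Y = refl
  ⋀-∧ {suc k} X Y = trans (∙-cong refl (⋀-∧ (λ i → X (suc i)) (λ i → Y (suc i))))
                          (interchange commutativeSemigroup _ _ _ _)

  ⋀-⊤ : ∀ {k} → ⋀ S {k} (λ _ → ⊤) ≈ ⊤
  ⋀-⊤ {k} = antisym x≤⊤ (⋀-greatest {k} _ (λ _ → ≤-refl))

  mergeFirstTwo : ∀ {k} → (Fin (suc (suc k)) → Carrier) → Fin (suc k) → Carrier
  mergeFirstTwo X zero = X zero ∧ X (suc zero)
  mergeFirstTwo X (suc j) = X (suc (suc j))

  ⋀-mergeFirstTwo : ∀ {k} (X : Fin (suc (suc k)) → Carrier) → ⋀ S (mergeFirstTwo X) ≈ ⋀ S X
  ⋀-mergeFirstTwo {zero} X = refl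
  ⋀-mergeFirstTwo {suc k} X = assoc _ _ _

  ⋀-punchIn≤ : ∀ {k} (X : Fin (suc (suc k)) → Carrier) i j → j ≢ i → ⋀ S (λ l → X (punchIn i l)) ≤ X j
  ⋀-punchIn≤ X i j j≢i = ≡.subst (λ l → ⋀ S (λ l → X (punchIn i l)) ≤ X l) (punchIn-punchOut i≢j)
                                  (⋀-lowerBound (λ l → X (punchIn i l)) (punchOut i≢j))
    where i≢j = λ i≡j → j≢i (≡.sym i≡j)

  if-∧ : ∀ b c x → (if b Bool.∧ c then ⊤ else x) ≈ ((if b then ⊤ else x) ∧ (if c then ⊤ else x))
  if-∧ true true x = sym (identityʳ ⊤)
  if-∧ true false x = sym (identityˡ x)
  if-∧ false true x = sym (identityʳ x)
  if-∧ false false x = sym (idem x)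

  ≤-if : ∀ b {y x} → y ≤ x → y ≤ (if b then ⊤ else x)
  ≤-if true _ = x≤⊤
  ≤-if false y≤x = y≤x

  T⇒≤-if : ∀ {b} {y} x → T b → y ≤ (if b then ⊤ else x)
  T⇒≤-if {true} x _ = x≤⊤

  ¬T⇒if≈ : ∀ {b} x → ¬ T b → (if b then ⊤ else x) ≈ x
  ¬T⇒if≈ {true} x ¬t = contradiction _ ¬t
  ¬T⇒if≈ {false} x _ = refl

  record IsFilter (P : Pred Carrier a) : Set a where
    field
      isUpset : IsUpset S P
      ⊤∈ : P ⊤
      ∧-closed : ∀ {x y} → P x → P y → P (x ∧ y)

    resp : ∀ {x y} → x ≈ y → P x → P y
    resp x≈y = upward isUpset (≤-reflexive x≈y)

    ∧-elimˡ : ∀ {x y} → P (x ∧ y) → P x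
    ∧-elimˡ = upward isUpset (x∧y≤x _ _)

    ∧-elimʳ : ∀ {x y} → P (x ∧ y) → P y
    ∧-elimʳ = upward isUpset (x∧y≤y _ _)

module _ {a : Level} {M N : RawMonoid a a} where
  private
    module M = RawMonoid M
    module N = RawMonoid N

  mkHom : ∀ {h : M.Carrier → N.Carrier} → (∀ {x y} → x M.≈ y → h x N.≈ h y) →
          (∀ x y → h (x M.∙ y) N.≈ (h x N.∙ h y)) → h M.ε N.≈ N.ε →
          MonoidMorphisms.IsMonoidHomomorphism M N h
  mkHom cong homo ε-homo = record
    { isMagmaHomomorphism = record { isRelHomomorphism = record { cong = cong } ; homo = homo }
    ; ε-homo = ε-homo }

module _ {a : Level} {S T : USL a} where
  private
    module T = IdempotentCommutativeMonoid T

  hom-monotone : ∀ {h} → IsHom S T h → ∀ {x y} → Order._≤_ S x y → Order._≤_ T (h x) (h y)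
  hom-monotone hom x≤y = T.trans (⟦⟧-cong x≤y) (homo _ _)
    where open MonoidMorphisms.IsMonoidHomomorphism hom

Boolean : {a : Level} → Set a → Str a
Boolean I = record
  { alg = record
    { Carrier = I → Bool
    ; _≈_ = λ f g → ∀ i → f i ≡ g i
    ; _∙_ = λ f g i → f i Bool.∧ g i
    ; ε = λ _ → true
    ; isIdempotentCommutativeMonoid = record
      { isCommutativeMonoid = Pointwise.isCommutativeMonoid I ∧-isCommutativeMonoid
      ; idem = λ f i → ∧-idem (f i) } }
  ; F = λ f → ∃ λ i → T (f i)
  ; F-resp = λ { f≈g (i , t) → i , ≡.subst T (f≈g i) t }
  }

𝔹 : {a : Level} → ℕ → Str a
𝔹 {a} n = Boolean (Lift a (Fin n))

module _ {a : Level} where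

  tuple : {A : Str a} (J : Set a) (C : J → Str a) (g : ∀ j → Str.Carrier A → Str.Carrier (C j)) →
          (∀ j → IsHom (Str.alg A) (Str.alg (C j)) (g j)) →
          (∀ x → Str.F A x ⇔ (∀ j → Str.F (C j) (g j x))) → StrictHom A (∏ J C)
  tuple J C g hom strict = record
    { fun = λ x j → g j x
    ; hom = mkHom (λ x≈y j → H.⟦⟧-cong j x≈y) (λ x y j → H.homo j x y) (λ j → H.ε-homo j)
    ; strict = strict }
    where module H j = MonoidMorphisms.IsMonoidHomomorphism (hom j)

  precompose : {I J : Set a} (σ : J → I) → (∀ i → ∃ λ j → σ j ≡ i) → StrictHom (Boolean I) (Boolean J)
  precompose σ σ-surjective = record
    { fun = λ f j → f (σ j)
    ; hom = mkHom (λ f≈g j → f≈g (σ j)) (λ _ _ _ → ≡.refl) (λ _ → ≡.refl)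
    ; strict = λ f → mk⇔ (λ (i , t) → let j , σj≡i = σ-surjective i in j , ≡.subst (λ i → T (f i)) (≡.sym σj≡i) t)
                         (λ (j , t) → σ j , t) }

clamp : ∀ {m n} → Fin n → Fin (suc m)
clamp {m} i with toℕ i ℕ.<? suc m
... | yes i≤m = fromℕ< i≤m
... | no _ = zero

clamp-inject≤ : ∀ {m n} (m<n : suc m ℕ.≤ n) (j : Fin (suc m)) → clamp (inject≤ j m<n) ≡ j
clamp-inject≤ {m} m<n j with toℕ (inject≤ j m<n) ℕ.<? suc m
... | yes lt = toℕ-injective (≡.trans (toℕ-fromℕ< lt) (toℕ-inject≤ j m<n))
... | no ¬lt = contradiction (≡.subst (ℕ._< suc m) (≡.sym (toℕ-inject≤ j m<n)) (toℕ<n j)) ¬lt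

module Classical {a : Level} (em : ExcludedMiddle a) where

  dne : DoubleNegationElimination a
  dne = em⇒dne em

  T-does : ∀ {P : Set a} (P? : Dec P) → T (does P?) ⇔ P
  T-does (yes p) = mk⇔ (λ _ → p) (λ _ → _)
  T-does (no ¬p) = mk⇔ (λ ()) ¬p

  module _ (S : USL a) {n : ℕ} (P : Fin n → Pred (IdempotentCommutativeMonoid.Carrier S) a)
           (isFilter : ∀ i → Order.IsFilter S (P i)) where
    open IdempotentCommutativeMonoid S
    private module P i = Order.IsFilter (isFilter i)

    indicator : Carrier → Str.Carrier (𝔹 {a} n)
    indicator x (lift i) = does (em {P i x})

    indicator-hom : IsHom S (Str.alg (𝔹 n)) indicator
    indicator-hom = mkHom
      (λ x≈y (lift i) → does-⇔ (mk⇔ (P.resp i x≈y) (P.resp i (sym x≈y))) em em)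
      (λ x y (lift i) → does-⇔ (mk⇔ (λ p → P.∧-elimˡ i p , P.∧-elimʳ i p) (λ (p , q) → P.∧-closed i p q))
                                em (em ×-dec em))
      (λ (lift i) → dec-true em (P.⊤∈ i))

    indicator-F : ∀ x → Str.F (𝔹 n) (indicator x) ⇔ ∃ λ i → P i x
    indicator-F x = mk⇔ (λ (lift i , t) → i , Equivalence.to (T-does em) t)
                        (λ (i , p) → lift i , Equivalence.from (T-does em) p)

  module _ (M : USL a) {G : Pred (IdempotentCommutativeMonoid.Carrier M) a} where
    open IdempotentCommutativeMonoid M renaming (ε to ⊤)
    open Order M

    finiteUpset⇒unionOfPrincipalFilters : IsFinite M → IsUpset M G → G ⊤ →
      ∃ λ N → Σ (Fin (suc N) → Carrier) λ c → ∀ y → G y ⇔ ∃ λ i → c i ≤ y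
    finiteUpset⇒unionOfPrincipalFilters (N , e , e-surjective) G-isUpset ⊤∈G = N , c , λ y → mk⇔ (to y) from
      where
        representative : ∀ y → Dec (G y) → Carrier
        representative y (yes _) = y
        representative y (no _) = ⊤

        -- the leading ⊤ keeps the family non-empty
        c : Fin (suc N) → Carrier
        c zero = ⊤
        c (suc i) = representative (e i) em

        c∈G : ∀ i → G (c i)
        c∈G zero = ⊤∈G
        c∈G (suc i) with em {G (e i)}
        ... | yes eᵢ∈G = eᵢ∈G
        ... | no _ = ⊤∈G

        representative≤ : ∀ {y} → G y → (y? : Dec (G y)) → representative y y? ≤ y
        representative≤ _ (yes _) = ≤-refl
        representative≤ y∈G (no y∉G) = contradiction y∈G y∉G

        to : ∀ y → G y → ∃ λ i → c i ≤ y
        to y y∈G with e-surjective y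
        ... | i , eᵢ≈y = suc i , ≤-trans (representative≤ eᵢ∈G em) (≤-reflexive eᵢ≈y)
          where eᵢ∈G = upward G-isUpset (≤-reflexive (sym eᵢ≈y)) y∈G

        from : ∀ {y} → (∃ λ i → c i ≤ y) → G y
        from (i , cᵢ≤y) = upward G-isUpset cᵢ≤y (c∈G i)

module FreeSemilattice {a : Level} (S : Setoid a a) where
  open Setoid S using (Carrier)
  open SetoidMembership S using (_∉_)
  open SetoidSubset S using (_⊆_)

  private
    ≡⇒⊆⊇ : ∀ {xs ys : List Carrier} → xs ≡ ys → xs ⊆ ys × ys ⊆ xs
    ≡⇒⊆⊇ ≡.refl = (λ p → p) , (λ p → p)

  freeSemilattice : USL a
  freeSemilattice = record
    { Carrier = List Carrier
    ; _≈_ = λ xs ys → xs ⊆ ys × ys ⊆ xs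
    ; _∙_ = _++_
    ; ε = []
    ; isIdempotentCommutativeMonoid = record
      { isCommutativeMonoid = record
        { isMonoid = record
          { isSemigroup = record
            { isMagma = record
              { isEquivalence = Setoid.isEquivalence (InducedEquivalence (⊆-preorder S))
              ; ∙-cong = λ (p , p′) (q , q′) → ++⁺ S p q , ++⁺ S p′ q′ }
            ; assoc = λ xs ys zs → ≡⇒⊆⊇ (++-assoc xs ys zs) }
          ; identity = (λ _ → ≡⇒⊆⊇ ≡.refl) , (λ xs → ≡⇒⊆⊇ (++-identityʳ xs)) }
        ; comm = λ xs ys → ∈-++-comm S xs ys , ∈-++-comm S ys xs }
      ; idem = λ xs → (λ p → [ (λ q → q) , (λ q → q) ] (∈-++⁻ S xs p)) , ∈-++⁺ˡ S }
    }

  ∉-isFilter : ∀ x → Order.IsFilter freeSemilattice (x ∉_)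
  ∉-isFilter x = record
    { isUpset = λ {xs} (xs++ys⊆xs , _) x∉xs x∈ys → x∉xs (xs++ys⊆xs (∈-++⁺ʳ S xs x∈ys))
    ; ⊤∈ = λ ()
    ; ∧-closed = λ {xs} x∉xs x∉ys x∈xs++ys → [ x∉xs , x∉ys ] (∈-++⁻ S xs x∈xs++ys) }

module ListMeet {a : Level} (S : USL a) where
  open IdempotentCommutativeMonoid S renaming (_∙_ to _∧_; ε to ⊤)
  open Order S
  open FreeSemilattice setoid public
  open SetoidMembership setoid using (_∈_)
  open SetoidSubset setoid using (_⊆_)

  ⋀ᴸ : List Carrier → Carrier
  ⋀ᴸ = foldr _∧_ ⊤

  ⋀ᴸ-lowerBound : ∀ {x xs} → x ∈ xs → ⋀ᴸ xs ≤ x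
  ⋀ᴸ-lowerBound (here x≈y) = ≤-trans (x∧y≤x _ _) (≤-reflexive (sym x≈y))
  ⋀ᴸ-lowerBound (there x∈xs) = ≤-trans (x∧y≤y _ _) (⋀ᴸ-lowerBound x∈xs)

  ⋀ᴸ-greatest : ∀ {z} xs → (∀ {x} → x ∈ xs → z ≤ x) → z ≤ ⋀ᴸ xs
  ⋀ᴸ-greatest [] _ = x≤⊤
  ⋀ᴸ-greatest (y ∷ xs) z≤ = ∧-greatest (z≤ (here refl)) (⋀ᴸ-greatest xs (λ x∈xs → z≤ (there x∈xs)))

  ⋀ᴸ-++ : ∀ xs ys → ⋀ᴸ (xs ++ ys) ≈ (⋀ᴸ xs ∧ ⋀ᴸ ys)
  ⋀ᴸ-++ [] ys = sym (identityˡ (⋀ᴸ ys))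
  ⋀ᴸ-++ (x ∷ xs) ys = trans (∙-cong refl (⋀ᴸ-++ xs ys)) (sym (assoc x (⋀ᴸ xs) (⋀ᴸ ys)))

  ⋀ᴸ≈⋀lookup : ∀ x xs → ⋀ᴸ (x ∷ xs) ≈ ⋀ S (lookup (x ∷ xs))
  ⋀ᴸ≈⋀lookup x [] = identityʳ x
  ⋀ᴸ≈⋀lookup x (y ∷ xs) = ∙-cong refl (⋀ᴸ≈⋀lookup y xs)

  ⋀ᴸ-antitone : ∀ {xs} ys → xs ⊆ ys → ⋀ᴸ ys ≤ ⋀ᴸ xs
  ⋀ᴸ-antitone {xs} ys xs⊆ys = ⋀ᴸ-greatest xs (λ x∈xs → ⋀ᴸ-lowerBound (xs⊆ys x∈xs))

  ⋀ᴸ-hom : IsHom freeSemilattice S ⋀ᴸ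
  ⋀ᴸ-hom = mkHom (λ {xs} {ys} (xs⊆ys , ys⊆xs) → antisym (⋀ᴸ-antitone xs ys⊆xs) (⋀ᴸ-antitone ys xs⊆ys)) ⋀ᴸ-++ refl

SmallMeetsIn : ∀ {a} (A : Str a) (n : ℕ) {k} → (Fin (suc k) → Str.Carrier A) → Set a
SmallMeetsIn A n {k} X = ∀ m (ι : Fin (suc m) → Fin (suc k)) → Injective _≡_ _≡_ ι → suc m ℕ.≤ n →
  Str.F A (⋀ (Str.alg A) (λ i → X (ι i)))

module Closure {a k : Level} {K : Class {a} k} (isLogical : IsLogicalClass K) where
  open IsLogicalClass isLogical

  fromStrictHom : ∀ {A B} → StrictHom A B → K B → K A
  fromStrictHom {A} {B} h B∈K = preimage toImage (λ x → x , B.refl) (sub fromImage (λ x≈y → x≈y) B∈K)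
    where
      module A = Str A
      module B = Str B
      open StrictHom h
      open MonoidMorphisms.IsMonoidHomomorphism hom

      -- the image of h, presented as A modulo the kernel of h
      kernelImage : Str a
      kernelImage = record
        { alg = record
          { Carrier = A.Carrier
          ; _≈_ = λ x y → fun x B.≈ fun y
          ; _∙_ = A._∙_
          ; ε = A.ε
          ; isIdempotentCommutativeMonoid = record
            { isCommutativeMonoid = record
              { isMonoid = record
                { isSemigroup = record
                  { isMagma = record
                    { isEquivalence = record { refl = B.refl ; sym = B.sym ; trans = B.trans }
                    ; ∙-cong = λ {x} {x'} {y} {y'} p q →
                        B.trans (homo x y) (B.trans (B.∙-cong p q) (B.sym (homo x' y'))) }
                  ; assoc = λ x y z → ⟦⟧-cong (A.assoc x y z) }
                ; identity = (λ x → ⟦⟧-cong (A.identityˡ x)) , (λ x → ⟦⟧-cong (A.identityʳ x)) }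
              ; comm = λ x y → ⟦⟧-cong (A.comm x y) }
            ; idem = λ x → ⟦⟧-cong (A.idem x) } }
        ; F = λ x → B.F (fun x)
        ; F-resp = B.F-resp }

      fromImage : StrictHom kernelImage B
      fromImage = record
        { fun = fun ; hom = mkHom (λ p → p) homo ε-homo ; strict = λ _ → mk⇔ (λ p → p) (λ p → p) }

      toImage : StrictHom A kernelImage
      toImage = record { fun = λ x → x ; hom = mkHom ⟦⟧-cong (λ _ _ → B.refl) B.refl ; strict = strict }

  𝔹-shrink : ∀ {m n} → suc m ℕ.≤ n → K (𝔹 n) → K (𝔹 (suc m))
  𝔹-shrink m<n = fromStrictHom (precompose (λ (lift i) → lift (clamp i))
    (λ (lift j) → lift (inject≤ j m<n) , ≡.cong lift (clamp-inject≤ m<n j)))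

  module _ (em : ExcludedMiddle a) where
    open Classical em

    intersectionOfFiniteUnionsOfFilters⇒∈K :
      (A : Str a) (J : Set a) (size : J → ℕ) (P : ∀ j → Fin (size j) → Pred (Str.Carrier A) a) →
      (∀ j i → Order.IsFilter (Str.alg A) (P j i)) → (∀ j → K (𝔹 (size j))) →
      (∀ x → Str.F A x ⇔ (∀ j → ∃ λ i → P j i x)) → K A
    intersectionOfFiniteUnionsOfFilters⇒∈K A J size P isFilter 𝔹∈K F⇔ =
      fromStrictHom (tuple J (λ j → 𝔹 (size j)) ind (λ j → indicator-hom (Str.alg A) (P j) (isFilter j)) strict)
                    (prod J (λ j → 𝔹 (size j)) 𝔹∈K)
      where
        ind : ∀ j → Str.Carrier A → Str.Carrier (𝔹 (size j))
        ind j = indicator (Str.alg A) (P j) (isFilter j)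

        strict : ∀ x → Str.F A x ⇔ (∀ j → Str.F (𝔹 (size j)) (ind j x))
        strict x = mk⇔ (λ Fx j → Equivalence.from (ind-F j) (Equivalence.to (F⇔ x) Fx j))
                       (λ F𝔹 → Equivalence.from (F⇔ x) (λ j → Equivalence.to (ind-F j) (F𝔹 j)))
          where ind-F = λ j → indicator-F (Str.alg A) (P j) (isFilter j) x

    module _ {A : Str a} (A∈K : K A) (F-isUpset : IsUpset (Str.alg A) (Str.F A)) (ε∈F : Str.F A (Str.ε A)) where
      open Str A using (Carrier; ε; F; F-resp; alg; reflexive; trans)
      open Order alg

      -- others i stands in for the meet of the elem j with j ≢ i, which is not a ⋀ when m = 0
      record Critical (m : ℕ) : Set a where
        field
          elem : Fin (suc m) → Carrier
          others : Fin (suc m) → Carrier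
          others∈F : ∀ i → F (others i)
          others≤ : ∀ i j → j ≢ i → others i ≤ elem j
          ⋀∉F : ¬ F (⋀ alg elem)

      critical-merge : ∀ {m} → Critical (suc m) → Critical m
      critical-merge c = record
        { elem = mergeFirstTwo elem
        ; others = λ i → others (suc i)
        ; others∈F = λ i → others∈F (suc i)
        ; others≤ = others≤′
        ; ⋀∉F = λ ⋀∈F → ⋀∉F (F-resp (⋀-mergeFirstTwo elem) ⋀∈F) }
        where
          open Critical c
          others≤′ : ∀ i j → j ≢ i → others (suc i) ≤ mergeFirstTwo elem j
          others≤′ zero zero 0≢0 = contradiction ≡.refl 0≢0
          others≤′ (suc i) zero _ = ∧-greatest (others≤ _ zero (λ ())) (others≤ _ (suc zero) (λ ()))
          others≤′ i (suc j) j≢i = others≤ (suc i) (suc (suc j)) (λ eq → j≢i (suc-injective eq))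

      critical-shrink : ∀ {m n} → n ℕ.≤′ m → Critical m → Critical n
      critical-shrink (ℕ.≤′-reflexive ≡.refl) c = c
      critical-shrink (ℕ.≤′-step n≤′m) c = critical-shrink n≤′m (critical-merge c)

      -- drop elements whose removal keeps the meet outside F, until none is left
      critical-find : ∀ {n k} (X : Fin (suc k) → Carrier) → SmallMeetsIn A n X → ¬ F (⋀ alg X) →
                      ∃ λ m → n ℕ.≤ m × Critical m
      critical-find {n} {k} X small ⋀X∉F with em {∀ i → ∃ λ c → F c × (∀ j → j ≢ i → c ≤ X j)}
      ... | yes others = k , n≤k , record
            { elem = X
            ; others = λ i → proj₁ (others i)
            ; others∈F = λ i → proj₁ (proj₂ (others i))
            ; others≤ = λ i → proj₂ (proj₂ (others i))
            ; ⋀∉F = ⋀X∉F }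
        where n≤k = ℕ.≮⇒≥ (λ k<n → ⋀X∉F (small k (λ i → i) (λ eq → eq) k<n))
      critical-find {k = zero} X small ⋀X∉F | no ¬others =
        contradiction (λ { zero → ε , ε∈F , λ { zero 0≢0 → contradiction ≡.refl 0≢0 } }) ¬others
      critical-find {k = suc _} X small ⋀X∉F | no ¬others with ¬∀⟶∃¬ _ _ (λ _ → em) ¬others
      ... | i , ¬othersᵢ = critical-find (λ j → X (punchIn i j))
              (λ m ι ι-injective →
                 small m (λ j → punchIn i (ι j)) (λ eq → ι-injective (punchIn-injective i _ _ eq)))
              (λ ⋀∈F → ¬othersᵢ (_ , ⋀∈F , ⋀-punchIn≤ X i))

      critical⇒𝔹∈K : ∀ {n} → Critical n → K (𝔹 (suc n))
      critical⇒𝔹∈K {n} c = fromStrictHom h A∈K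
        where
          open Critical c

          g : Str.Carrier (𝔹 (suc n)) → Carrier
          g f = ⋀ alg (λ j → if f (lift j) then ε else elem j)

          g-F : ∀ f → Str.F (𝔹 (suc n)) f ⇔ F (g f)
          g-F f = mk⇔ (λ (lift i , t) → upward F-isUpset (⋀-greatest _ (bound i t)) (others∈F i))
                      (λ Fgf → dne λ ¬∃ →
                         ⋀∉F (F-resp (⋀-cong (λ j → ¬T⇒if≈ (elem j) (λ t → ¬∃ (lift j , t)))) Fgf))
            where
              bound : ∀ i → T (f (lift i)) → ∀ j → others i ≤ (if f (lift j) then ε else elem j)
              bound i t j with j ≟ i
              ... | yes ≡.refl = T⇒≤-if (elem j) t
              ... | no j≢i = ≤-if (f (lift j)) (others≤ i j j≢i)

          h : StrictHom (𝔹 (suc n)) A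
          h = record
            { fun = g
            ; hom = mkHom
                (λ f≈f′ → ⋀-cong (λ j → reflexive (≡.cong (λ b → if b then ε else elem j) (f≈f′ (lift j)))))
                (λ f f′ → trans (⋀-cong (λ j → if-∧ (f (lift j)) (f′ (lift j)) (elem j))) (⋀-∧ {n} _ _))
                (⋀-⊤ {n})
            ; strict = g-F }

      nFilterViolation⇒𝔹∈K : ∀ {n k} (X : Fin (suc k) → Carrier) → SmallMeetsIn A n X → ¬ F (⋀ alg X) →
                              K (𝔹 (suc n))
      nFilterViolation⇒𝔹∈K X small ⋀X∉F with critical-find X small ⋀X∉F
      ... | m , n≤m , c = critical⇒𝔹∈K (critical-shrink (ℕ.≤⇒≤′ n≤m) c)

    uSL⇒∈K : ∀ {n} → K (𝔹 n) → ∀ A → uSL n A → K A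
    uSL⇒∈K {n} 𝔹n∈K A ((x₀ , x₀∈F) , F-isUpset , nFilter) =
      image ⋀ᴸ-strictHom (λ x → x ∷ [] , identityʳ x) (intersectionOfFiniteUnionsOfFilters⇒∈K freeCover
        SmallFailure (λ (m , _) → suc m) (λ (_ , E , _) i xs → E i ∉ xs) (λ (_ , E , _) i → ∉-isFilter (E i))
        (λ (_ , _ , m<n , _) → 𝔹-shrink m<n 𝔹n∈K) F⇔)
      where
        open Str A using (Carrier; ε; F; F-resp; alg; setoid; identityʳ; sym)
        open Order alg
        open ListMeet alg
        open SetoidMembership setoid using (_∉_)

        ε∈F : F ε
        ε∈F = upward F-isUpset x≤⊤ x₀∈F

        freeCover : Str a
        freeCover = record
          { alg = freeSemilattice
          ; F = λ xs → F (⋀ᴸ xs)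
          ; F-resp = λ xs≈ys → F-resp (MonoidMorphisms.IsMonoidHomomorphism.⟦⟧-cong ⋀ᴸ-hom xs≈ys) }

        ⋀ᴸ-strictHom : StrictHom freeCover A
        ⋀ᴸ-strictHom = record { fun = ⋀ᴸ ; hom = ⋀ᴸ-hom ; strict = λ _ → mk⇔ (λ p → p) (λ p → p) }

        SmallFailure : Set a
        SmallFailure = ∃ λ m → Σ (Fin (suc m) → Carrier) λ E → suc m ℕ.≤ n × ¬ F (⋀ alg E)

        MissesEachSmallFailure : List Carrier → Set a
        MissesEachSmallFailure xs = ∀ ((_ , E , _) : SmallFailure) → ∃ λ i → E i ∉ xs

        F⇒misses : ∀ xs → F (⋀ᴸ xs) → MissesEachSmallFailure xs
        F⇒misses xs F⋀ᴸ (_ , E , _ , ⋀E∉F) = dne λ ¬∃ →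
          let E⊆xs = λ i → dne (λ Eᵢ∉xs → ¬∃ (i , Eᵢ∉xs))
          in ⋀E∉F (upward F-isUpset (⋀-greatest E (λ i → ⋀ᴸ-lowerBound (E⊆xs i))) F⋀ᴸ)

        misses⇒F : ∀ xs → MissesEachSmallFailure xs → F (⋀ᴸ xs)
        misses⇒F [] _ = ε∈F
        misses⇒F (y ∷ ys) misses = F-resp (sym (⋀ᴸ≈⋀lookup y ys)) (nFilter (length ys) X small)
          where
            X = lookup (y ∷ ys)
            small : SmallMeetsIn A n X
            small m ι _ m<n = dne λ ⋀∉F →
              let i , Xιᵢ∉ys = misses (m , (λ i → X (ι i)) , m<n , ⋀∉F)
              in Xιᵢ∉ys (∈-lookup setoid (y ∷ ys) (ι i))

        F⇔ : ∀ xs → F (⋀ᴸ xs) ⇔ MissesEachSmallFailure xs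
        F⇔ xs = mk⇔ (F⇒misses xs) (misses⇒F xs)

    uSLω⇒∈K : (∀ N → K (𝔹 (suc N))) → ∀ A → uSLω A → K A
    uSLω⇒∈K 𝔹∈K A ((x₀ , x₀∈F) , _ , J , M , h , G , finite , h-hom , G-isUpset , F⇔) =
      intersectionOfFiniteUnionsOfFilters⇒∈K A J (λ j → suc (N j)) P isFilter (λ j → 𝔹∈K (N j)) F⇔⋃
      where
        open Str A using (Carrier; F; alg)
        module M j = IdempotentCommutativeMonoid (M j)
        module Mₒ j = Order (M j)
        module H j = MonoidMorphisms.IsMonoidHomomorphism (h-hom j)

        cover : ∀ j → ∃ λ N → Σ (Fin (suc N) → M.Carrier j) λ c →
                  ∀ y → G j y ⇔ ∃ λ i → Mₒ._≤_ j (c i) y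
        cover j = finiteUpset⇒unionOfPrincipalFilters (M j) (finite j) (G-isUpset j)
          (upward (G-isUpset j) (Mₒ.x≤⊤ j) (Equivalence.to (F⇔ x₀) x₀∈F j))
          where open Order (M j) using (upward)

        N : J → ℕ
        N j = proj₁ (cover j)

        P : ∀ j → Fin (suc (N j)) → Pred Carrier a
        P j i x = Mₒ._≤_ j (proj₁ (proj₂ (cover j)) i) (h j x)

        isFilter : ∀ j i → Order.IsFilter alg (P j i)
        isFilter j i = record
          { isUpset = λ x∧y≈x cᵢ≤hx →
              Mₒ.≤-trans j cᵢ≤hx (hom-monotone {S = alg} {T = M j} (h-hom j) (Str.sym A x∧y≈x))
          ; ⊤∈ = Mₒ.≤-trans j (Mₒ.x≤⊤ j) (Mₒ.≤-reflexive j (M.sym j (H.ε-homo j)))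
          ; ∧-closed = λ {x} {y} cᵢ≤hx cᵢ≤hy →
              Mₒ.≤-trans j (Mₒ.∧-greatest j cᵢ≤hx cᵢ≤hy) (Mₒ.≤-reflexive j (M.sym j (H.homo j x y))) }

        F⇔⋃ : ∀ x → F x ⇔ (∀ j → ∃ λ i → P j i x)
        F⇔⋃ x = mk⇔ (λ Fx j → Equivalence.to (G⇔ j) (Equivalence.to (F⇔ x) Fx j))
                    (λ ⋃ → Equivalence.from (F⇔ x) (λ j → Equivalence.from (G⇔ j) (⋃ j)))
          where G⇔ = λ j → proj₂ (proj₂ (cover j)) (h j x)

    module _ (K⊆uSL∞ : K ⊆ᶜ uSL∞) where

      ε∈F : ∀ A → K A → Str.F A (Str.ε A)
      ε∈F A A∈K = let (x , x∈F) , F-isUpset = K⊆uSL∞ A A∈K in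
        Order.upward (Str.alg A) F-isUpset (Order.x≤⊤ (Str.alg A)) x∈F

      counterexample⇒𝔹₁∈K : ∀ A → K A → ∀ x → ¬ Str.F A x → K (𝔹 1)
      counterexample⇒𝔹₁∈K A A∈K x x∉F =
        nFilterViolation⇒𝔹∈K A∈K (proj₂ (K⊆uSL∞ A A∈K)) (ε∈F A A∈K) {k = 0} (λ _ → x) (λ _ _ _ ())
                                     x∉F

      𝔹∉K⇒⊆uSL : ∀ {n} → ¬ K (𝔹 (suc n)) → K ⊆ᶜ uSL n
      𝔹∉K⇒⊆uSL 𝔹∉K A A∈K = F-nonEmpty , F-isUpset ,
        λ _ X small → dne λ ⋀X∉F →
          𝔹∉K (nFilterViolation⇒𝔹∈K A∈K F-isUpset (ε∈F A A∈K) X small ⋀X∉F)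
        where
          F-nonEmpty = proj₁ (K⊆uSL∞ A A∈K)
          F-isUpset = proj₂ (K⊆uSL∞ A A∈K)

lowerExcludedMiddle : ∀ {ℓ ℓ′} → ExcludedMiddle (ℓ ⊔ ℓ′) → ExcludedMiddle ℓ
lowerExcludedMiddle {ℓ′ = ℓ′} em = map′ lower lift (em {Lift ℓ′ _})

crossing : ∀ {p} (P : ℕ → Set p) → (∀ n → Dec (P n)) → P 0 → ∀ N → ¬ P N →
           ∃ λ n → P n × ¬ P (suc n)
crossing P P? P0 zero ¬P0 = contradiction P0 ¬P0
crossing P P? P0 (suc N) ¬PN+1 with P? N
... | yes PN = N , PN , ¬PN+1
... | no ¬PN = crossing P P? P0 N ¬PN

mainTheorem15 : {a k : Level} → ExcludedMiddle (lsuc a ⊔ k) → (K : Class {a} k) →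
    IsLogicalClass K → ¬ Trivial K → K ⊆ᶜ uSL∞ →
    (uSLω ⊆ᶜ K) ⊎ (∃ λ (n : ℕ) → n ≥ 1 × (K ≐ᶜ uSL n))
mainTheorem15 {a} {k} em K isLogical nonTrivial K⊆uSL∞ = dichotomy emᵏ
  where
    open Closure isLogical

    emᵃ : ExcludedMiddle a
    emᵃ = lowerExcludedMiddle em

    emᵏ : ExcludedMiddle k
    emᵏ = lowerExcludedMiddle {k} {lsuc a} em

    dneᵏ : DoubleNegationElimination k
    dneᵏ = em⇒dne emᵏ

    𝔹₁∈K : K (𝔹 1)
    𝔹₁∈K = dneᵏ λ 𝔹₁∉K → nonTrivial λ A A∈K x →
      Classical.dne emᵃ λ x∉F → 𝔹₁∉K (counterexample⇒𝔹₁∈K emᵃ K⊆uSL∞ A A∈K x x∉F)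

    dichotomy : Dec (∀ N → K (𝔹 (suc N))) → (uSLω ⊆ᶜ K) ⊎ (∃ λ (n : ℕ) → n ≥ 1 × (K ≐ᶜ uSL n))
    dichotomy (yes 𝔹∈K) = inj₁ (uSLω⇒∈K emᵃ 𝔹∈K)
    dichotomy (no ¬𝔹∈K) =
      let N , 𝔹N∉K = dneᵏ λ ¬∃ → ¬𝔹∈K λ N → dneᵏ λ 𝔹N∉K → ¬∃ (N , 𝔹N∉K)
          n , 𝔹n∈K , 𝔹n+1∉K = crossing (λ N → K (𝔹 (suc N))) (λ _ → emᵏ) 𝔹₁∈K N 𝔹N∉K
      in inj₂ (suc n , s≤s z≤n , λ A →
           mk⇔ (𝔹∉K⇒⊆uSL emᵃ K⊆uSL∞ 𝔹n+1∉K A) (uSL⇒∈K emᵃ 𝔹n∈K A))
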